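{- For any fixed positive integers $t_1,t_2$, $$\lim_{n\to\infty} p\big(n,2,(t_1,t_2)\big)=\frac14 .$$
   Context: $[2]^n$ is the set of all sequences $\vec y=(y_1,\ldots,y_n)$ with $y_j\in\{1,2\}$. A family $\mathcal{F}\subset[2]^n$ is $(t_1,t_2)$-intersecting if for all $\vec y,\vec z\in\mathcal{F}$ (not necessarily distinct) and each $\ell\in\{1,2\}$, the number of coordinates $j$ with $y_j=z_j=\ell$ is at least $t_\ell$. Define $p(n,2,(t_1,t_2))=\max\{|\mathcal{F}|/2^n:\ \mathcal{F}\subset[2]^n \text{ is } (t_1,t_2)\text{ -intersecting}\}$. -}

module Defs where

open import Data.Nat using (ℕ; zero; suc; _+_; _^_; _≤_; _≤?_)
open import Data.Nat.Properties using (m^n≢0)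
open import Data.Fin using (Fin)
open import Data.Fin.Properties using () renaming (_≟_ to _≟ᶠ_)
open import Data.Vec using (Vec; []; _∷_)
open import Data.List using (List; []; _∷_; _++_; map; length; filter; foldr)
open import Data.List.Relation.Unary.All using (All; all?)
open import Data.Integer using (+_)
open import Data.Rational using (ℚ; _/_)
open import Relation.Nullary using (Dec; yes; no)
open import Relation.Nullary.Decidable using (_×-dec_)
open import Data.Product using (_×_)

-- Coordinates take values in [2] = Fin 2 (zero ↔ 1, suc zero ↔ 2).
-- A sequence in [2]^n is a Vec (Fin 2) n.
Seq : ℕ → Set
Seq n = Vec (Fin 2) n

agree : ∀ {n} → Fin 2 → Seq n → Seq n → ℕ
agree ℓ [] [] = 0
agree ℓ (y ∷ ys) (z ∷ zs) with y ≟ᶠ ℓ | z ≟ᶠ ℓ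
... | yes _ | yes _ = suc (agree ℓ ys zs)
... | _     | _     = agree ℓ ys zs

Pair-ok : ∀ {n} → ℕ → ℕ → Seq n → Seq n → Set
Pair-ok t₁ t₂ y z = (t₁ ≤ agree Fin.zero y z) × (t₂ ≤ agree (Fin.suc Fin.zero) y z)
  where open import Data.Fin using (zero; suc)

Intersecting : ∀ {n} → ℕ → ℕ → List (Seq n) → Set
Intersecting t₁ t₂ F = All (λ y → All (λ z → Pair-ok t₁ t₂ y z) F) F

pair-ok? : ∀ {n} t₁ t₂ (y z : Seq n) → Dec (Pair-ok t₁ t₂ y z)
pair-ok? t₁ t₂ y z = (t₁ ≤? _) ×-dec (t₂ ≤? _)

intersecting? : ∀ {n} t₁ t₂ (F : List (Seq n)) → Dec (Intersecting t₁ t₂ F)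
intersecting? t₁ t₂ F = all? (λ y → all? (λ z → pair-ok? t₁ t₂ y z) F) F

allSeqs : (n : ℕ) → List (Seq n)
allSeqs zero = [] ∷ []
allSeqs (suc n) = map (Fin.zero ∷_) (allSeqs n) ++ map (Fin.suc Fin.zero ∷_) (allSeqs n)
  where open import Data.Fin using (zero; suc)

-- All sublists of a list (= all subsets when the list has no repetitions).
sublists : ∀ {A : Set} → List A → List (List A)
sublists [] = [] ∷ []
sublists (x ∷ xs) = sublists xs ++ map (x ∷_) (sublists xs)

maxℕ : List ℕ → ℕ
maxℕ = foldr Data.Nat._⊔_ 0
  where import Data.Nat

maxFamily : ℕ → ℕ → ℕ → ℕ
maxFamily n t₁ t₂ = maxℕ (map length (filter (intersecting? t₁ t₂) (sublists (allSeqs n))))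

p : ℕ → ℕ → ℕ → ℚ
p n t₁ t₂ = (+ maxFamily n t₁ t₂ / (2 ^ n)) {{m^n≢0 2 n}}

-- A (t₁,t₂)-intersecting family F with t₁, t₂ ≥ 1 lies in U ∩ D, where U and D are
-- its up- and down-closures for the coordinatewise order 1 < 2. Neither U nor D contains a sequence
-- together with its complement, for the two members of F below (above) them would share no 2 (no 1).
-- Hence |U|, |D| ≤ 2ⁿ⁻¹, and the Harris–Kleitman inequality 2ⁿ |U ∩ D| ≤ |U| |D| gives |F| ≤ 2ⁿ⁻².
--
-- Split the coordinates into blocks of sizes a and b and take the sequences with at
-- least k₁ ≥ (a + t₁)/2 symbols 1 in the first block and at least k₂ ≥ (b + t₂)/2 symbols 2 in the
-- second. The density of this family is a product of two binomial tails, each falling short of 1/2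
-- by at most t + 1 binomial coefficients, and (2m choose m)² (2m + 1) ≤ 16ᵐ makes every binomial
-- coefficient of a block of size a at most 2ᵃ/√a, so both tails tend to 1/2.

module Submission where

open import Defs
open import Data.Nat using (ℕ; _≥_)
open import Data.Integer using (+_)
open import Data.Rational using (ℚ; _/_; _-_; ∣_∣; _<_; 0ℚ)
open import Data.Product using (∃)

open import Data.Bool using (Bool; true; false; T; not; _∧_; if_then_else_)
open import Data.Bool.Properties using (T-∧)
open import Data.Empty using (⊥; ⊥-elim)
import Data.Empty.Irrelevant as Irrelevant
open import Data.Fin using (Fin; zero; suc; opposite)
import Data.Fin as Fin
import Data.Fin.Properties as Fin
open import Data.Fin.Properties using (_≟_)
open import Data.Integer using (-[1+_]; +<+)
import Data.Integer as ℤ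
import Data.Integer.Properties as ℤ
open import Data.List using (List; []; _∷_; _++_; map; length; filter)
open import Data.List.Membership.Propositional using (_∈_; find; lose)
open import Data.List.Membership.Propositional.Properties using (∈-++⁻; ∈-++⁺ˡ; ∈-++⁺ʳ; ∈-map⁺; ∈-map⁻; ∈-filter⁺; ∈-filter⁻)
open import Data.List.Properties using (filter-all; filter-++; length-++)
open import Data.List.Relation.Binary.Sublist.Propositional using (_⊆_; []; _∷_; _∷ʳ_)
open import Data.List.Relation.Binary.Sublist.Propositional.Properties using (filter⁺; filter-⊆; length-mono-≤)
open import Data.List.Relation.Unary.All as All using (All; []; _∷_; tabulate; lookup)
open import Data.List.Relation.Unary.All.Properties using (all-filter)
open import Data.List.Relation.Unary.Any as Any using (here; there; any?)
open import Data.Nat using (zero; suc; _+_; _*_; _^_; _∸_; _≤_; _≤ᵇ_; z≤n; s≤s; NonZero)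
import Data.Nat as ℕ
open import Data.Nat.Combinatorics using (_C_; nCk+nC[k+1]≡[n+1]C[k+1]; nC1≡n; nCk≡nC[n∸k])
open import Data.Nat.Coprimality using (Coprime)
open import Data.Nat.Properties hiding (_≟_)
open import Data.Nat.Tactic.RingSolver using (solve-∀)
open import Data.Product using (_×_; _,_; proj₁; proj₂)
open import Data.Rational using (mkℚ; *<*; toℚᵘ) renaming (-_ to -ℚ_)
import Data.Rational.Properties as ℚ
open import Data.Rational.Unnormalised using (mkℚᵘ; _≃_)
import Data.Rational.Unnormalised as ℚᵘ
import Data.Rational.Unnormalised.Properties as ℚᵘ
open import Data.Sum using (_⊎_; inj₁; inj₂)
open import Data.Unit using (tt)
open import Data.Vec using (Vec; []; _∷_; take; drop)
import Data.Vec as Vec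
open import Data.Vec.Relation.Binary.Pointwise.Inductive as Pointwise using (Pointwise; []; _∷_)
open import Function using (_∘_; _∘′_; Equivalence)
open import Relation.Binary.PropositionalEquality using (_≡_; refl; sym; trans; cong; cong₂; subst; subst₂; module ≡-Reasoning)
open import Relation.Nullary using (Dec; yes; no; contradiction)
open import Relation.Nullary.Decidable using (T?; isYes; toWitness; fromWitness)

⊆⇒∈-sublists : ∀ {A : Set} {xs ys : List A} → ys ⊆ xs → ys ∈ sublists xs
⊆⇒∈-sublists []         = here refl
⊆⇒∈-sublists (x ∷ʳ τ)   = ∈-++⁺ˡ (⊆⇒∈-sublists τ)
⊆⇒∈-sublists (refl ∷ τ) = ∈-++⁺ʳ _ (∈-map⁺ _ (⊆⇒∈-sublists τ))

∈-sublists⇒⊆ : ∀ {A : Set} (xs : List A) {ys} → ys ∈ sublists xs → ys ⊆ xs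
∈-sublists⇒⊆ []       (here refl) = []
∈-sublists⇒⊆ (x ∷ xs) ys∈ with ∈-++⁻ (sublists xs) ys∈
... | inj₁ ys∈′ = x ∷ʳ ∈-sublists⇒⊆ xs ys∈′
... | inj₂ ys∈′ with ∈-map⁻ (x ∷_) ys∈′
...   | _ , zs∈ , refl = refl ∷ ∈-sublists⇒⊆ xs zs∈

∈⇒≤maxℕ : ∀ {xs : List ℕ} {x} → x ∈ xs → x ≤ maxℕ xs
∈⇒≤maxℕ {y ∷ xs} (here refl) = m≤m⊔n y (maxℕ xs)
∈⇒≤maxℕ {y ∷ xs} (there x∈)  = ≤-trans (∈⇒≤maxℕ x∈) (m≤n⊔m y (maxℕ xs))

maxℕ≤ : ∀ {xs : List ℕ} {b} → All (_≤ b) xs → maxℕ xs ≤ b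
maxℕ≤ []         = z≤n
maxℕ≤ (x≤ ∷ xs≤) = ⊔-lub x≤ (maxℕ≤ xs≤)

length-filter-map : ∀ {A B : Set} (P : B → Bool) (f : A → B) xs →
                    length (filter (T? ∘ P) (map f xs)) ≡ length (filter (T? ∘ P ∘ f) xs)
length-filter-map P f []       = refl
length-filter-map P f (x ∷ xs) with P (f x)
... | true  = cong suc (length-filter-map P f xs)
... | false = length-filter-map P f xs

-- Counting sequences

count : ∀ n → (Seq n → Bool) → ℕ
count zero    P = if P [] then 1 else 0
count (suc n) P = count n (P ∘ (zero ∷_)) + count n (P ∘ (suc zero ∷_))

count-cong : ∀ n {P Q : Seq n → Bool} → (∀ x → P x ≡ Q x) → count n P ≡ count n Q
count-cong zero    P≗Q rewrite P≗Q [] = refl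
count-cong (suc n) P≗Q = cong₂ _+_ (count-cong n (P≗Q ∘ (zero ∷_))) (count-cong n (P≗Q ∘ (suc zero ∷_)))

count-mono : ∀ n {P Q : Seq n → Bool} → (∀ y → T (P y) → T (Q y)) → count n P ≤ count n Q
count-mono zero    {P} {Q} P⇒Q with P [] | Q [] | P⇒Q []
... | true  | true  | _   = ≤-refl
... | true  | false | P⇒Q[] = ⊥-elim (P⇒Q[] tt)
... | false | _     | _   = z≤n
count-mono (suc n) P⇒Q = +-mono-≤ (count-mono n (P⇒Q ∘ (zero ∷_))) (count-mono n (P⇒Q ∘ (suc zero ∷_)))

count-true : ∀ n → count n (λ _ → true) ≡ 2 ^ n
count-true zero    = refl
count-true (suc n) = trans (cong₂ _+_ (count-true n) (count-true n)) (cong (_+_ (2 ^ n)) (sym (+-identityʳ (2 ^ n))))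

count-false : ∀ n → count n (λ _ → false) ≡ 0
count-false zero    = refl
count-false (suc n) = cong₂ _+_ (count-false n) (count-false n)

count+count-not : ∀ n (P : Seq n → Bool) → count n P + count n (not ∘ P) ≡ 2 ^ n
count+count-not zero    P with P []
... | true  = refl
... | false = refl
count+count-not (suc n) P = begin
  (count n P₀ + count n P₁) + (count n (not ∘ P₀) + count n (not ∘ P₁))
    ≡⟨ interchange (count n P₀) _ _ _ ⟩
  (count n P₀ + count n (not ∘ P₀)) + (count n P₁ + count n (not ∘ P₁))
    ≡⟨ cong₂ _+_ (count+count-not n P₀) (count+count-not n P₁) ⟩
  2 ^ n + 2 ^ n
    ≡⟨ cong (_+_ (2 ^ n)) (+-identityʳ (2 ^ n)) ⟨
  2 ^ suc n ∎
  where
  open ≡-Reasoning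
  P₀ P₁ : Seq n → Bool
  P₀ = P ∘ (zero ∷_)
  P₁ = P ∘ (suc zero ∷_)
  interchange : ∀ a b c d → (a + b) + (c + d) ≡ (a + c) + (b + d)
  interchange = solve-∀

count-take-drop : ∀ a {b} (P : Seq a → Bool) (Q : Seq b → Bool) →
                  count (a + b) (λ v → P (take a v) ∧ Q (drop a v)) ≡ count a P * count b Q
count-take-drop zero {b} P Q with P []
... | true  = sym (+-identityʳ (count b Q))
... | false = count-false b
count-take-drop (suc a) {b} P Q = begin
  count (a + b) (λ v → P (zero ∷ take a v) ∧ Q (drop a v)) + count (a + b) (λ v → P (suc zero ∷ take a v) ∧ Q (drop a v))
    ≡⟨ cong₂ _+_ (count-take-drop a (P ∘ (zero ∷_)) Q) (count-take-drop a (P ∘ (suc zero ∷_)) Q) ⟩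
  count a (P ∘ (zero ∷_)) * count b Q + count a (P ∘ (suc zero ∷_)) * count b Q
    ≡⟨ *-distribʳ-+ (count b Q) (count a (P ∘ (zero ∷_))) _ ⟨
  count (suc a) P * count b Q ∎
  where open ≡-Reasoning

complement : ∀ {n} → Seq n → Seq n
complement = Vec.map opposite

count-complement : ∀ n (P : Seq n → Bool) → count n (P ∘ complement) ≡ count n P
count-complement zero    P = refl
count-complement (suc n) P = begin
  count n (P ∘ (suc zero ∷_) ∘ complement) + count n (P ∘ (zero ∷_) ∘ complement)
    ≡⟨ cong₂ _+_ (count-complement n (P ∘ (suc zero ∷_))) (count-complement n (P ∘ (zero ∷_))) ⟩
  count n (P ∘ (suc zero ∷_)) + count n (P ∘ (zero ∷_))
    ≡⟨ +-comm (count n (P ∘ (suc zero ∷_))) _ ⟩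
  count (suc n) P ∎
  where open ≡-Reasoning

count-antipodal-free : ∀ n (P : Seq (suc n) → Bool) → (∀ y → T (P y) → T (P (complement y)) → ⊥) →
                       count (suc n) P ≤ 2 ^ n
count-antipodal-free n P antipodal-free = begin
  count n P₀ + count n P₁                 ≡⟨ cong (_+_ (count n P₀)) (count-complement n P₁) ⟨
  count n P₀ + count n (P₁ ∘ complement)  ≤⟨ +-monoʳ-≤ (count n P₀) (count-mono n P₁̅⇒¬P₀) ⟩
  count n P₀ + count n (not ∘ P₀)         ≡⟨ count+count-not n P₀ ⟩
  2 ^ n                                   ∎
  where
  open ≤-Reasoning
  P₀ P₁ : Seq n → Bool
  P₀ = P ∘ (zero ∷_)
  P₁ = P ∘ (suc zero ∷_)
  P₁̅⇒¬P₀ : ∀ y → T (P₁ (complement y)) → T (not (P₀ y))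
  P₁̅⇒¬P₀ y P₁y̅ with P₀ y in eq
  ... | true  = antipodal-free (zero ∷ y) (subst T (sym eq) tt) P₁y̅
  ... | false = tt

length-filter-allSeqs : ∀ n (P : Seq n → Bool) → length (filter (T? ∘ P) (allSeqs n)) ≡ count n P
length-filter-allSeqs zero    P with P []
... | true  = refl
... | false = refl
length-filter-allSeqs (suc n) P = begin
  length (filter (T? ∘ P) (map (zero ∷_) all ++ map (suc zero ∷_) all))
    ≡⟨ cong length (filter-++ (T? ∘ P) (map (zero ∷_) all) _) ⟩
  length (filter (T? ∘ P) (map (zero ∷_) all) ++ filter (T? ∘ P) (map (suc zero ∷_) all))
    ≡⟨ length-++ (filter (T? ∘ P) (map (zero ∷_) all)) ⟩
  length (filter (T? ∘ P) (map (zero ∷_) all)) + length (filter (T? ∘ P) (map (suc zero ∷_) all))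
    ≡⟨ cong₂ _+_ (length-filter-map P (zero ∷_) all) (length-filter-map P (suc zero ∷_) all) ⟩
  length (filter (T? ∘ P ∘ (zero ∷_)) all) + length (filter (T? ∘ P ∘ (suc zero ∷_)) all)
    ≡⟨ cong₂ _+_ (length-filter-allSeqs n (P ∘ (zero ∷_))) (length-filter-allSeqs n (P ∘ (suc zero ∷_))) ⟩
  count (suc n) P ∎
  where
  open ≡-Reasoning
  all = allSeqs n

length≤count : ∀ {n} (P : Seq n → Bool) {F} → F ⊆ allSeqs n → All (T ∘ P) F → length F ≤ count n P
length≤count {n} P {F} F⊆ PF = begin
  length F                             ≡⟨ cong length (filter-all (T? ∘ P) PF) ⟨
  length (filter (T? ∘ P) F)           ≤⟨ length-mono-≤ (filter⁺ (T? ∘ P) (T? ∘ P) (λ { refl p → p }) F⊆) ⟩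
  length (filter (T? ∘ P) (allSeqs n)) ≡⟨ length-filter-allSeqs n P ⟩
  count n P                            ∎
  where open ≤-Reasoning

maxFamily≤ : ∀ {n t₁ t₂ b} → (∀ {F} → F ⊆ allSeqs n → Intersecting t₁ t₂ F → length F ≤ b) →
             maxFamily n t₁ t₂ ≤ b
maxFamily≤ {n} {t₁} {t₂} {b} bound = maxℕ≤ (tabulate bounded)
  where
  bounded : ∀ {l} → l ∈ map length (filter (intersecting? t₁ t₂) (sublists (allSeqs n))) → l ≤ b
  bounded l∈ with ∈-map⁻ length l∈
  ... | F , F∈ , refl with ∈-filter⁻ (intersecting? t₁ t₂) F∈
  ...   | F∈sublists , intersecting = bound (∈-sublists⇒⊆ (allSeqs n) F∈sublists) intersecting

count≤maxFamily : ∀ {n t₁ t₂} (P : Seq n → Bool) → (∀ {y z} → T (P y) → T (P z) → Pair-ok t₁ t₂ y z) →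
                  count n P ≤ maxFamily n t₁ t₂
count≤maxFamily {n} {t₁} {t₂} P ok = subst (_≤ maxFamily n t₁ t₂) (length-filter-allSeqs n P)
  (∈⇒≤maxℕ (∈-map⁺ length (∈-filter⁺ (intersecting? t₁ t₂) (⊆⇒∈-sublists (filter-⊆ (T? ∘ P) (allSeqs n))) intersecting)))
  where
  PF : All (T ∘ P) (filter (T? ∘ P) (allSeqs n))
  PF = all-filter (T? ∘ P) (allSeqs n)
  intersecting : Intersecting t₁ t₂ (filter (T? ∘ P) (allSeqs n))
  intersecting = All.map (λ Py → All.map (ok Py) PF) PF

-- The Harris–Kleitman inequality

infix 4 _≤ˢ_ _≤ˢ?_

_≤ˢ_ : ∀ {n} → Seq n → Seq n → Set
_≤ˢ_ = Pointwise Fin._≤_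

_≤ˢ?_ : ∀ {n} (x y : Seq n) → Dec (x ≤ˢ y)
_≤ˢ?_ = Pointwise.decidable Fin._≤?_

≤ˢ-refl : ∀ {n} {x : Seq n} → x ≤ˢ x
≤ˢ-refl = Pointwise.refl Fin.≤-refl

≤ˢ-trans : ∀ {n} {x y z : Seq n} → x ≤ˢ y → y ≤ˢ z → x ≤ˢ z
≤ˢ-trans = Pointwise.trans Fin.≤-trans

IsUpSet IsDownSet : ∀ {n} → (Seq n → Bool) → Set
IsUpSet   U = ∀ {x y} → x ≤ˢ y → T (U x) → T (U y)
IsDownSet D = ∀ {x y} → x ≤ˢ y → T (D y) → T (D x)

chebyshev : ∀ {u₀ u₁ d₀ d₁} → u₀ ≤ u₁ → d₁ ≤ d₀ → 2 * (u₀ * d₀ + u₁ * d₁) ≤ (u₀ + u₁) * (d₀ + d₁)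
chebyshev {u₀} {d₁ = d₁} u₀≤u₁ d₁≤d₀ with m≤n⇒∃[o]m+o≡n u₀≤u₁ | m≤n⇒∃[o]m+o≡n d₁≤d₀
... | x , refl | y , refl = ≤-trans (m≤m+n _ (x * y)) (≤-reflexive (identity u₀ x d₁ y))
  where
  identity : ∀ u x d y → 2 * (u * (d + y) + (u + x) * d) + x * y ≡ (u + (u + x)) * (d + y + d)
  identity = solve-∀

harris-kleitman : ∀ n {U D : Seq n → Bool} → IsUpSet U → IsDownSet D →
                  2 ^ n * count n (λ y → U y ∧ D y) ≤ count n U * count n D
harris-kleitman zero {U} {D} _ _ with U [] | D []
... | true  | true  = ≤-refl
... | true  | false = z≤n
... | false | _     = z≤n
harris-kleitman (suc n) {U} {D} up down = begin
  2 ^ suc n * (count n UD₀ + count n UD₁)                 ≡⟨ identity (2 ^ n) (count n UD₀) _ ⟩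
  2 * (2 ^ n * count n UD₀ + 2 ^ n * count n UD₁)         ≤⟨ *-monoʳ-≤ 2 (+-mono-≤ (slice zero) (slice (suc zero))) ⟩
  2 * (u₀ * d₀ + u₁ * d₁)                                 ≤⟨ chebyshev (count-mono n λ y → up (z≤n ∷ ≤ˢ-refl))
                                                                        (count-mono n λ y → down (z≤n ∷ ≤ˢ-refl)) ⟩
  (u₀ + u₁) * (d₀ + d₁)                                   ∎
  where
  open ≤-Reasoning
  identity : ∀ p a b → (2 * p) * (a + b) ≡ 2 * (p * a + p * b)
  identity = solve-∀
  UD₀ UD₁ : Seq n → Bool
  UD₀ y = U (zero ∷ y) ∧ D (zero ∷ y)
  UD₁ y = U (suc zero ∷ y) ∧ D (suc zero ∷ y)
  u₀ = count n (U ∘ (zero ∷_))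
  u₁ = count n (U ∘ (suc zero ∷_))
  d₀ = count n (D ∘ (zero ∷_))
  d₁ = count n (D ∘ (suc zero ∷_))
  slice : ∀ i → 2 ^ n * count n (λ y → U (i ∷ y) ∧ D (i ∷ y)) ≤ count n (U ∘ (i ∷_)) * count n (D ∘ (i ∷_))
  slice i = harris-kleitman n (up ∘ (Fin.≤-refl ∷_)) (down ∘ (Fin.≤-refl ∷_))

-- Upper bound

upClosure downClosure : ∀ {n} → List (Seq n) → Seq n → Bool
upClosure   F y = isYes (any? (_≤ˢ? y) F)
downClosure F y = isYes (any? (y ≤ˢ?_) F)

upClosure-isUpSet : ∀ {n} (F : List (Seq n)) → IsUpSet (upClosure F)
upClosure-isUpSet F x≤y Ux = fromWitness (Any.map (λ z≤x → ≤ˢ-trans z≤x x≤y) (toWitness Ux))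

downClosure-isDownSet : ∀ {n} (F : List (Seq n)) → IsDownSet (downClosure F)
downClosure-isDownSet F x≤y Dy = fromWitness (Any.map (≤ˢ-trans x≤y) (toWitness Dy))

∈⇒upClosure : ∀ {n} {F : List (Seq n)} {x} → x ∈ F → T (upClosure F x)
∈⇒upClosure x∈ = fromWitness (lose x∈ ≤ˢ-refl)

∈⇒downClosure : ∀ {n} {F : List (Seq n)} {x} → x ∈ F → T (downClosure F x)
∈⇒downClosure x∈ = fromWitness (lose x∈ ≤ˢ-refl)

below-complement⇒agree₂≡0 : ∀ {n} {x x′ y : Seq n} → x ≤ˢ y → x′ ≤ˢ complement y → agree (suc zero) x x′ ≡ 0
below-complement⇒agree₂≡0 [] [] = refl
below-complement⇒agree₂≡0 {x = zero ∷ _}     {y = _ ∷ _} (_ ∷ p) (_ ∷ q) = below-complement⇒agree₂≡0 p q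
below-complement⇒agree₂≡0 {x = suc zero ∷ _} {zero ∷ _} {_ ∷ _} (_ ∷ p) (_ ∷ q) = below-complement⇒agree₂≡0 p q
below-complement⇒agree₂≡0 {x = suc zero ∷ _} {suc zero ∷ _} {zero ∷ _}     (() ∷ _) _
below-complement⇒agree₂≡0 {x = suc zero ∷ _} {suc zero ∷ _} {suc zero ∷ _} _ (() ∷ _)

above-complement⇒agree₁≡0 : ∀ {n} {x x′ y : Seq n} → y ≤ˢ x → complement y ≤ˢ x′ → agree zero x x′ ≡ 0
above-complement⇒agree₁≡0 [] [] = refl
above-complement⇒agree₁≡0 {x = suc zero ∷ _} {y = _ ∷ _} (_ ∷ p) (_ ∷ q) = above-complement⇒agree₁≡0 p q
above-complement⇒agree₁≡0 {x = zero ∷ _} {suc zero ∷ _} {_ ∷ _} (_ ∷ p) (_ ∷ q) = above-complement⇒agree₁≡0 p q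
above-complement⇒agree₁≡0 {x = zero ∷ _} {zero ∷ _} {zero ∷ _}     _ (() ∷ _)
above-complement⇒agree₁≡0 {x = zero ∷ _} {zero ∷ _} {suc zero ∷ _} (() ∷ _) _

intersecting-length≤ : ∀ k {t₁ t₂} → 1 ≤ t₁ → 1 ≤ t₂ → {F : List (Seq (2 + k))} →
                       F ⊆ allSeqs (2 + k) → Intersecting t₁ t₂ F → length F ≤ 2 ^ k
intersecting-length≤ k {t₁} {t₂} 1≤t₁ 1≤t₂ {F} F⊆ intersecting = *-cancelˡ-≤ (2 ^ n) {{m^n≢0 2 n}} (begin
  2 ^ n * length F                   ≤⟨ *-monoʳ-≤ (2 ^ n) (length≤count UD F⊆ (tabulate F⊆UD)) ⟩
  2 ^ n * count n UD                 ≤⟨ harris-kleitman n (upClosure-isUpSet F) (downClosure-isDownSet F) ⟩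
  count n U * count n D              ≤⟨ *-mono-≤ (count-antipodal-free (suc k) U U-antipodal-free)
                                                 (count-antipodal-free (suc k) D D-antipodal-free) ⟩
  2 ^ suc k * 2 ^ suc k              ≡⟨ identity (2 ^ k) ⟩
  2 ^ n * 2 ^ k                      ∎)
  where
  open ≤-Reasoning
  n = 2 + k
  U D UD : Seq n → Bool
  U = upClosure F
  D = downClosure F
  UD y = U y ∧ D y
  identity : ∀ p → (2 * p) * (2 * p) ≡ (2 * (2 * p)) * p
  identity = solve-∀
  F⊆UD : ∀ {x} → x ∈ F → T (UD x)
  F⊆UD {x} x∈ = Equivalence.from (T-∧ {U x} {D x}) (∈⇒upClosure x∈ , ∈⇒downClosure x∈)
  U-antipodal-free : ∀ y → T (U y) → T (U (complement y)) → ⊥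
  U-antipodal-free y Uy Uy̅ with find (toWitness Uy) | find (toWitness Uy̅)
  ... | x , x∈ , x≤y | x′ , x′∈ , x′≤y̅ =
    <⇒≱ 1≤t₂ (subst (t₂ ≤_) (below-complement⇒agree₂≡0 x≤y x′≤y̅) (proj₂ (lookup (lookup intersecting x∈) x′∈)))
  D-antipodal-free : ∀ y → T (D y) → T (D (complement y)) → ⊥
  D-antipodal-free y Dy Dy̅ with find (toWitness Dy) | find (toWitness Dy̅)
  ... | x , x∈ , y≤x | x′ , x′∈ , y̅≤x′ =
    <⇒≱ 1≤t₁ (subst (t₁ ≤_) (above-complement⇒agree₁≡0 y≤x y̅≤x′) (proj₁ (lookup (lookup intersecting x∈) x′∈)))

maxFamily-upper : ∀ k {t₁ t₂} → 1 ≤ t₁ → 1 ≤ t₂ → maxFamily (2 + k) t₁ t₂ ≤ 2 ^ k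
maxFamily-upper k 1≤t₁ 1≤t₂ = maxFamily≤ (intersecting-length≤ k 1≤t₁ 1≤t₂)

4*maxFamily≤2^n : ∀ {n t₁ t₂} → 1 ≤ t₁ → 1 ≤ t₂ → 2 ≤ n → 4 * maxFamily n t₁ t₂ ≤ 2 ^ n
4*maxFamily≤2^n {suc (suc k)} 1≤t₁ 1≤t₂ (s≤s (s≤s _)) =
  ≤-trans (*-monoʳ-≤ 4 (maxFamily-upper k 1≤t₁ 1≤t₂)) (≤-reflexive (identity (2 ^ k)))
  where
  identity : ∀ p → 4 * p ≡ 2 * (2 * p)
  identity = solve-∀

-- Binomial coefficients

[k+1]*[n+1]C[k+1]≡[n+1]*nCk : ∀ n k → suc k * (suc n C suc k) ≡ suc n * (n C k)
[k+1]*[n+1]C[k+1]≡[n+1]*nCk zero    zero    = refl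
[k+1]*[n+1]C[k+1]≡[n+1]*nCk zero    (suc k) = *-zeroʳ (2 + k)
[k+1]*[n+1]C[k+1]≡[n+1]*nCk (suc n) zero    = trans (*-identityˡ _) (trans (nC1≡n (2 + n)) (sym (*-identityʳ (2 + n))))
[k+1]*[n+1]C[k+1]≡[n+1]*nCk (suc n) (suc k) = begin
  (2 + k) * ((2 + n) C (2 + k))
    ≡⟨ cong ((2 + k) *_) (nCk+nC[k+1]≡[n+1]C[k+1] (suc n) (suc k)) ⟨
  (2 + k) * (x + (1 + n) C (2 + k))
    ≡⟨ identity₁ k x _ ⟩
  x + (1 + k) * x + (2 + k) * ((1 + n) C (2 + k))
    ≡⟨ cong₂ (λ u v → x + u + v) ([k+1]*[n+1]C[k+1]≡[n+1]*nCk n k) ([k+1]*[n+1]C[k+1]≡[n+1]*nCk n (suc k)) ⟩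
  x + (1 + n) * (n C k) + (1 + n) * (n C suc k)
    ≡⟨ identity₂ n x _ _ ⟩
  x + (1 + n) * (n C k + n C suc k)
    ≡⟨ cong (λ u → x + (1 + n) * u) (nCk+nC[k+1]≡[n+1]C[k+1] n k) ⟩
  (2 + n) * x ∎
  where
  open ≡-Reasoning
  x = (1 + n) C (1 + k)
  identity₁ : ∀ k x y → (2 + k) * (x + y) ≡ x + (1 + k) * x + (2 + k) * y
  identity₁ = solve-∀
  identity₂ : ∀ n x p q → x + (1 + n) * p + (1 + n) * q ≡ x + (1 + n) * (p + q)
  identity₂ = solve-∀

[k+1]*nC[k+1]+k*nCk≡n*nCk : ∀ n k → suc k * (n C suc k) + k * (n C k) ≡ n * (n C k)
[k+1]*nC[k+1]+k*nCk≡n*nCk n k = +-cancelˡ-≡ (n C k) _ _ (begin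
  n C k + (suc k * (n C suc k) + k * (n C k))    ≡⟨ identity k (n C k) (n C suc k) ⟩
  suc k * (n C k + n C suc k)                    ≡⟨ cong (suc k *_) (nCk+nC[k+1]≡[n+1]C[k+1] n k) ⟩
  suc k * (suc n C suc k)                        ≡⟨ [k+1]*[n+1]C[k+1]≡[n+1]*nCk n k ⟩
  n C k + n * (n C k)                            ∎)
  where
  open ≡-Reasoning
  identity : ∀ k p q → p + ((1 + k) * q + k * p) ≡ (1 + k) * (p + q)
  identity = solve-∀

nCk≤nC[k+1] : ∀ {n k} → suc (k + k) ≤ n → n C k ≤ n C suc k
nCk≤nC[k+1] {n} {k} 2k<n = *-cancelˡ-≤ (suc k) (+-cancelʳ-≤ (k * (n C k)) _ _ (begin
  suc k * (n C k) + k * (n C k)          ≡⟨ *-distribʳ-+ (n C k) (suc k) k ⟨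
  suc (k + k) * (n C k)                  ≤⟨ *-monoˡ-≤ (n C k) 2k<n ⟩
  n * (n C k)                            ≡⟨ [k+1]*nC[k+1]+k*nCk≡n*nCk n k ⟨
  suc k * (n C suc k) + k * (n C k)      ∎))
  where open ≤-Reasoning

nC[k+1]≤nCk : ∀ {n k} → n ≤ suc (k + k) → n C suc k ≤ n C k
nC[k+1]≤nCk {n} {k} n≤2k+1 = *-cancelˡ-≤ (suc k) (+-cancelʳ-≤ (k * (n C k)) _ _ (begin
  suc k * (n C suc k) + k * (n C k)      ≡⟨ [k+1]*nC[k+1]+k*nCk≡n*nCk n k ⟩
  n * (n C k)                            ≤⟨ *-monoˡ-≤ (n C k) n≤2k+1 ⟩
  suc (k + k) * (n C k)                  ≡⟨ *-distribʳ-+ (n C k) (suc k) k ⟩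
  suc k * (n C k) + k * (n C k)          ∎))
  where open ≤-Reasoning

increasing-≤ : ∀ (f : ℕ → ℕ) {k m} → (∀ {i} → i ℕ.< m → f i ≤ f (suc i)) → k ≤ m → f k ≤ f m
increasing-≤ f {m = zero} _ z≤n = ≤-refl
increasing-≤ f {k} {suc m} step k≤1+m with m≤n⇒m<n∨m≡n k≤1+m
... | inj₂ refl  = ≤-refl
... | inj₁ k<1+m = ≤-trans (increasing-≤ f (step ∘′ m<n⇒m<1+n) (m<1+n⇒m≤n k<1+m)) (step (n<1+n m))

decreasing-≤ : ∀ (f : ℕ → ℕ) {m k} → (∀ {i} → m ≤ i → f (suc i) ≤ f i) → m ≤ k → f k ≤ f m
decreasing-≤ f {k = zero} _ z≤n = ≤-refl
decreasing-≤ f {m} {suc k} step m≤1+k with m≤n⇒m<n∨m≡n m≤1+k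
... | inj₂ refl  = ≤-refl
... | inj₁ m<1+k = ≤-trans (step m≤k) (decreasing-≤ f step m≤k)
  where m≤k = m<1+n⇒m≤n m<1+k

[2m]Ck≤[2m]Cm : ∀ m k → (m + m) C k ≤ (m + m) C m
[2m]Ck≤[2m]Cm m k with ≤-total k m
... | inj₁ k≤m = increasing-≤ ((m + m) C_) (λ i<m → nCk≤nC[k+1] (+-mono-≤ i<m (<⇒≤ i<m))) k≤m
... | inj₂ m≤k = decreasing-≤ ((m + m) C_) (λ m≤i → nC[k+1]≤nCk (m≤n⇒m≤1+n (+-mono-≤ m≤i m≤i))) m≤k

[m+1]*[2m+2]C[m+1]≡2*[2m+1]*[2m]Cm : ∀ m → suc m * ((2 + (m + m)) C suc m) ≡ 2 * (suc (m + m) * ((m + m) C m))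
[m+1]*[2m+2]C[m+1]≡2*[2m+1]*[2m]Cm m = begin
  suc m * ((2 + (m + m)) C suc m)       ≡⟨ [k+1]*[n+1]C[k+1]≡[n+1]*nCk (suc (m + m)) m ⟩
  (2 + (m + m)) * (suc (m + m) C m)     ≡⟨ identity m (suc (m + m) C m) ⟩
  2 * (suc m * (suc (m + m) C m))       ≡⟨ cong (λ x → 2 * (suc m * x)) symmetry ⟩
  2 * (suc m * (suc (m + m) C suc m))   ≡⟨ cong (2 *_) ([k+1]*[n+1]C[k+1]≡[n+1]*nCk (m + m) m) ⟩
  2 * (suc (m + m) * ((m + m) C m))     ∎
  where
  open ≡-Reasoning
  identity : ∀ m x → (2 + (m + m)) * x ≡ 2 * (suc m * x)
  identity = solve-∀
  symmetry : (suc m + m) C m ≡ (suc m + m) C suc m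
  symmetry = trans (nCk≡nC[n∸k] (m≤n+m m (suc m))) (cong ((suc m + m) C_) (m+n∸n≡m (suc m) m))

[2m]Cm²*[2m+1]≤2^[2m]² : ∀ m → ((m + m) C m) * ((m + m) C m) * suc (m + m) ≤ 2 ^ (m + m) * 2 ^ (m + m)
[2m]Cm²*[2m+1]≤2^[2m]² zero    = ≤-refl
[2m]Cm²*[2m+1]≤2^[2m]² (suc m) rewrite +-suc m m = *-cancelˡ-≤ (suc m * suc m) (begin
  suc m * suc m * (c′ * c′ * (3 + n))
    ≡⟨ identity₁ (suc m) c′ (3 + n) ⟩
  (suc m * c′) * (suc m * c′) * (3 + n)
    ≡⟨ cong (λ x → x * x * (3 + n)) ([m+1]*[2m+2]C[m+1]≡2*[2m+1]*[2m]Cm m) ⟩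
  (2 * (suc n * c)) * (2 * (suc n * c)) * (3 + n)
    ≡⟨ identity₂ n c ⟩
  (4 * (suc n * (3 + n))) * (c * c * suc n)
    ≤⟨ *-mono-≤ (*-monoʳ-≤ 4 [2m+1][2m+3]≤4[m+1]²) ([2m]Cm²*[2m+1]≤2^[2m]² m) ⟩
  (4 * (4 * (suc m * suc m))) * (2ⁿ * 2ⁿ)
    ≡⟨ identity₃ (suc m * suc m) 2ⁿ ⟩
  suc m * suc m * ((2 * (2 * 2ⁿ)) * (2 * (2 * 2ⁿ))) ∎)
  where
  open ≤-Reasoning
  n = m + m
  c = n C m
  c′ = (2 + n) C suc m
  2ⁿ = 2 ^ n
  identity₁ : ∀ s x z → s * s * (x * x * z) ≡ (s * x) * (s * x) * z
  identity₁ = solve-∀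
  identity₂ : ∀ n c → (2 * (suc n * c)) * (2 * (suc n * c)) * (3 + n) ≡ (4 * (suc n * (3 + n))) * (c * c * suc n)
  identity₂ = solve-∀
  identity₃ : ∀ s p → (4 * (4 * s)) * (p * p) ≡ s * ((2 * (2 * p)) * (2 * (2 * p)))
  identity₃ = solve-∀
  [2m+1][2m+3]+1≡4[m+1]² : ∀ m → suc (m + m) * (3 + (m + m)) + 1 ≡ 4 * (suc m * suc m)
  [2m+1][2m+3]+1≡4[m+1]² = solve-∀
  [2m+1][2m+3]≤4[m+1]² : suc n * (3 + n) ≤ 4 * (suc m * suc m)
  [2m+1][2m+3]≤4[m+1]² = ≤-trans (m≤m+n _ 1) (≤-reflexive ([2m+1][2m+3]+1≡4[m+1]² m))

[2m+1]Ck≤2*[2m]Cm : ∀ m k → suc (m + m) C k ≤ 2 * ((m + m) C m)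
[2m+1]Ck≤2*[2m]Cm m zero    = ≤-trans ([2m]Ck≤[2m]Cm m 0) (m≤m+n _ _)
[2m+1]Ck≤2*[2m]Cm m (suc k) = begin
  suc (m + m) C suc k                ≡⟨ nCk+nC[k+1]≡[n+1]C[k+1] (m + m) k ⟨
  (m + m) C k + (m + m) C suc k      ≤⟨ +-mono-≤ ([2m]Ck≤[2m]Cm m k) (≤-trans ([2m]Ck≤[2m]Cm m (suc k)) (m≤m+n _ 0)) ⟩
  2 * ((m + m) C m)                  ∎
  where open ≤-Reasoning

m*m≤n*n⇒m≤n : ∀ {m n} → m * m ≤ n * n → m ≤ n
m*m≤n*n⇒m≤n m²≤n² = ≮⇒≥ (λ n<m → <⇒≱ (*-mono-< n<m n<m) m²≤n²)

K*[2m]Cm≤2^[2m] : ∀ K m → K * K ≤ suc (m + m) → K * ((m + m) C m) ≤ 2 ^ (m + m)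
K*[2m]Cm≤2^[2m] K m K²≤2m+1 = m*m≤n*n⇒m≤n (begin
  (K * c) * (K * c)              ≡⟨ identity K c ⟩
  c * c * (K * K)                ≤⟨ *-monoʳ-≤ (c * c) K²≤2m+1 ⟩
  c * c * suc (m + m)            ≤⟨ [2m]Cm²*[2m+1]≤2^[2m]² m ⟩
  2 ^ (m + m) * 2 ^ (m + m)      ∎)
  where
  open ≤-Reasoning
  c = (m + m) C m
  identity : ∀ K c → (K * c) * (K * c) ≡ c * c * (K * K)
  identity = solve-∀

even⊎odd : ∀ n → ∃ λ m → n ≡ m + m ⊎ n ≡ suc (m + m)
even⊎odd zero = 0 , inj₁ refl
even⊎odd (suc n) with even⊎odd n
... | m , inj₁ refl = m , inj₂ refl
... | m , inj₂ refl = suc m , inj₁ (cong suc (sym (+-suc m m)))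

K*nCk≤2^n : ∀ K {n} → K * K ≤ n → ∀ k → K * (n C k) ≤ 2 ^ n
K*nCk≤2^n K {n} K²≤n k with even⊎odd n
... | m , inj₁ refl = ≤-trans (*-monoʳ-≤ K ([2m]Ck≤[2m]Cm m k)) (K*[2m]Cm≤2^[2m] K m (m≤n⇒m≤1+n K²≤n))
... | m , inj₂ refl = begin
  K * (suc (m + m) C k)          ≤⟨ *-monoʳ-≤ K ([2m+1]Ck≤2*[2m]Cm m k) ⟩
  K * (2 * ((m + m) C m))        ≡⟨ identity K ((m + m) C m) ⟩
  2 * (K * ((m + m) C m))        ≤⟨ *-monoʳ-≤ 2 (K*[2m]Cm≤2^[2m] K m K²≤n) ⟩
  2 * 2 ^ (m + m)                ∎
  where
  open ≤-Reasoning
  identity : ∀ K c → K * (2 * c) ≡ 2 * (K * c)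
  identity = solve-∀

infixl 6.5 _C≥_

-- n C≥ k = Σ_{l ≥ k} n C l, the number of subsets of an n-set with at least k elements.
_C≥_ : ℕ → ℕ → ℕ
n     C≥ zero  = 2 ^ n
zero  C≥ suc k = 0
suc n C≥ suc k = n C≥ k + n C≥ suc k

nC≥k≡nCk+nC≥[k+1] : ∀ n k → n C≥ k ≡ n C k + n C≥ suc k
nC≥k≡nCk+nC≥[k+1] zero    zero    = refl
nC≥k≡nCk+nC≥[k+1] zero    (suc k) = refl
nC≥k≡nCk+nC≥[k+1] (suc n) zero    = begin
  2 ^ n + (2 ^ n + 0)          ≡⟨ cong (_+_ (2 ^ n)) (+-identityʳ (2 ^ n)) ⟩
  2 ^ n + 2 ^ n                ≡⟨ cong (_+_ (2 ^ n)) (nC≥k≡nCk+nC≥[k+1] n zero) ⟩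
  2 ^ n + suc (n C≥ 1)         ≡⟨ +-suc (2 ^ n) (n C≥ 1) ⟩
  suc (2 ^ n + n C≥ 1)         ∎
  where open ≡-Reasoning
nC≥k≡nCk+nC≥[k+1] (suc n) (suc k) = begin
  n C≥ k + n C≥ suc k
    ≡⟨ cong₂ _+_ (nC≥k≡nCk+nC≥[k+1] n k) (nC≥k≡nCk+nC≥[k+1] n (suc k)) ⟩
  (n C k + n C≥ suc k) + (n C suc k + n C≥ suc (suc k))
    ≡⟨ interchange (n C k) _ _ _ ⟩
  (n C k + n C suc k) + (n C≥ suc k + n C≥ suc (suc k))
    ≡⟨ cong (_+ suc n C≥ suc (suc k)) (nCk+nC[k+1]≡[n+1]C[k+1] n k) ⟩
  suc n C suc k + suc n C≥ suc (suc k) ∎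
  where
  open ≡-Reasoning
  interchange : ∀ a b c d → (a + b) + (c + d) ≡ (a + c) + (b + d)
  interchange = solve-∀

n<k⇒nC≥k≡0 : ∀ {n k} → n ℕ.< k → n C≥ k ≡ 0
n<k⇒nC≥k≡0 {zero}  {suc k} _         = refl
n<k⇒nC≥k≡0 {suc n} {suc k} (s≤s n<k) = cong₂ _+_ (n<k⇒nC≥k≡0 n<k) (n<k⇒nC≥k≡0 (m<n⇒m<1+n n<k))

nC≥k≤2^n : ∀ n k → n C≥ k ≤ 2 ^ n
nC≥k≤2^n n       zero    = ≤-refl
nC≥k≤2^n zero    (suc k) = z≤n
nC≥k≤2^n (suc n) (suc k) = +-mono-≤ (nC≥k≤2^n n k) (≤-trans (nC≥k≤2^n n (suc k)) (m≤m+n _ 0))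

nC≥i+nC≥k≡2^n : ∀ n i k → i + k ≡ suc n → n C≥ i + n C≥ k ≡ 2 ^ n
nC≥i+nC≥k≡2^n n       zero    k       refl = trans (cong (_+_ (2 ^ n)) (n<k⇒nC≥k≡0 {n} ≤-refl)) (+-identityʳ (2 ^ n))
nC≥i+nC≥k≡2^n n       (suc i) zero    eq   =
  cong (_+ 2 ^ n) (n<k⇒nC≥k≡0 (≤-reflexive (trans (sym eq) (+-identityʳ (suc i)))))
nC≥i+nC≥k≡2^n zero    (suc i) (suc k) eq   = contradiction (suc-injective eq) (m+1+n≢0 i)
nC≥i+nC≥k≡2^n (suc n) (suc i) (suc k) eq   = begin
  (n C≥ i + n C≥ suc i) + (n C≥ k + n C≥ suc k)
    ≡⟨ rearrange (n C≥ i) _ _ _ ⟩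
  (n C≥ i + n C≥ suc k) + (n C≥ suc i + n C≥ k)
    ≡⟨ cong₂ _+_ (nC≥i+nC≥k≡2^n n i (suc k) (suc-injective eq))
                 (nC≥i+nC≥k≡2^n n (suc i) k (trans (sym (+-suc i k)) (suc-injective eq))) ⟩
  2 ^ n + 2 ^ n
    ≡⟨ cong (_+_ (2 ^ n)) (+-identityʳ (2 ^ n)) ⟨
  2 ^ suc n ∎
  where
  open ≡-Reasoning
  rearrange : ∀ a b c d → (a + b) + (c + d) ≡ (a + d) + (b + c)
  rearrange = solve-∀

K*nC≥i≤K*nC≥[i+w]+w*X : ∀ K {X} n → (∀ l → K * (n C l) ≤ X) → ∀ i w → K * (n C≥ i) ≤ K * (n C≥ (i + w)) + w * X
K*nC≥i≤K*nC≥[i+w]+w*X K {X} n bound i zero    rewrite +-identityʳ i = m≤m+n (K * (n C≥ i)) 0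
K*nC≥i≤K*nC≥[i+w]+w*X K {X} n bound i (suc w) = begin
  K * (n C≥ i)                                       ≡⟨ cong (K *_) (nC≥k≡nCk+nC≥[k+1] n i) ⟩
  K * (n C i + n C≥ suc i)                           ≡⟨ *-distribˡ-+ K (n C i) _ ⟩
  K * (n C i) + K * (n C≥ suc i)                     ≤⟨ +-mono-≤ (bound i) (K*nC≥i≤K*nC≥[i+w]+w*X K n bound (suc i) w) ⟩
  X + (K * (n C≥ (suc i + w)) + w * X)               ≡⟨ cong (λ j → X + (K * (n C≥ j) + w * X)) (+-suc i w) ⟨
  X + (K * (n C≥ (i + suc w)) + w * X)               ≡⟨ identity X (K * (n C≥ (i + suc w))) w ⟩
  K * (n C≥ (i + suc w)) + suc w * X                 ∎
  where
  open ≤-Reasoning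
  identity : ∀ x y w → x + (y + w * x) ≡ y + (1 + w) * x
  identity = solve-∀

-- Lower bound

infix 4 _≳[_]_

-- u ≳[ M ] X says that u ≥ (1 - 1/M) X.
_≳[_]_ : ℕ → ℕ → ℕ → Set
u ≳[ M ] X = M * X ≤ M * u + X

≳-mono-≤ : ∀ {M X u u′} → u ≤ u′ → u ≳[ M ] X → u′ ≳[ M ] X
≳-mono-≤ {M} {X} u≤u′ u≳X = ≤-trans u≳X (+-monoˡ-≤ X (*-monoʳ-≤ M u≤u′))

≳-* : ∀ {M X Y u v} → u ≳[ 3 * M ] X → v ≳[ 3 * M ] Y → u ≤ 2 * X → u * v ≳[ M ] X * Y
≳-* {M} {X} {Y} {u} {v} u≳X v≳Y u≤2X = *-cancelˡ-≤ 3 (begin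
  3 * (M * (X * Y))                           ≡⟨ identity₁ M X Y ⟩
  (3 * M * X) * Y                             ≤⟨ *-monoˡ-≤ Y u≳X ⟩
  (3 * M * u + X) * Y                         ≡⟨ identity₂ M X Y u ⟩
  u * (3 * M * Y) + X * Y                     ≤⟨ +-monoˡ-≤ (X * Y) (*-monoʳ-≤ u v≳Y) ⟩
  u * (3 * M * v + Y) + X * Y                 ≡⟨ identity₃ M X Y u v ⟩
  3 * M * (u * v) + u * Y + X * Y             ≤⟨ +-monoˡ-≤ (X * Y) (+-monoʳ-≤ (3 * M * (u * v)) (*-monoˡ-≤ Y u≤2X)) ⟩
  3 * M * (u * v) + 2 * X * Y + X * Y         ≡⟨ identity₄ M X Y u v ⟩
  3 * (M * (u * v) + X * Y)                   ∎)
  where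
  open ≤-Reasoning
  identity₁ : ∀ M X Y → 3 * (M * (X * Y)) ≡ (3 * M * X) * Y
  identity₁ = solve-∀
  identity₂ : ∀ M X Y u → (3 * M * u + X) * Y ≡ u * (3 * M * Y) + X * Y
  identity₂ = solve-∀
  identity₃ : ∀ M X Y u v → u * (3 * M * v + Y) + X * Y ≡ 3 * M * (u * v) + u * Y + X * Y
  identity₃ = solve-∀
  identity₄ : ∀ M X Y u v → 3 * M * (u * v) + 2 * X * Y + X * Y ≡ 3 * (M * (u * v) + X * Y)
  identity₄ = solve-∀

≳⇒*∸≤ : ∀ {M X u} → u ≳[ M ] X → M * (X ∸ u) ≤ X
≳⇒*∸≤ {M} {X} {u} u≳X = begin
  M * (X ∸ u)      ≡⟨ *-distribˡ-∸ M X u ⟩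
  M * X ∸ M * u    ≤⟨ m≤n+o⇒m∸n≤o (M * X) (M * u) u≳X ⟩
  X                ∎
  where open ≤-Reasoning

∃[i,w]i+[i+w]≡n : ∀ {t n} → t ≤ n → ∃ λ i → ∃ λ w → t ≤ w × w ≤ suc t × i + (i + w) ≡ n
∃[i,w]i+[i+w]≡n {t} {n} t≤n with even⊎odd (n ∸ t)
... | j , inj₁ n∸t≡j+j   = j , t , ≤-refl , n≤1+n t , (begin
  j + (j + t)        ≡⟨ +-assoc j j t ⟨
  j + j + t          ≡⟨ cong (_+ t) n∸t≡j+j ⟨
  n ∸ t + t          ≡⟨ m∸n+n≡m t≤n ⟩
  n                  ∎)
  where open ≡-Reasoning
... | j , inj₂ n∸t≡1+j+j = j , suc t , n≤1+n t , ≤-refl , (begin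
  j + (j + suc t)    ≡⟨ identity j t ⟩
  suc (j + j) + t    ≡⟨ cong (_+ t) n∸t≡1+j+j ⟨
  n ∸ t + t          ≡⟨ m∸n+n≡m t≤n ⟩
  n                  ∎)
  where
  open ≡-Reasoning
  identity : ∀ j t → j + (j + suc t) ≡ suc (j + j) + t
  identity = solve-∀

n+t≤[i+w]+[i+w] : ∀ {n t} i w → t ≤ suc w → i + (i + w) ≡ suc n → n + t ≤ (i + w) + (i + w)
n+t≤[i+w]+[i+w] {n} {t} i w t≤1+w i+k≡1+n = begin
  n + t                  ≤⟨ +-monoʳ-≤ n t≤1+w ⟩
  n + suc w              ≡⟨ +-suc n w ⟩
  suc n + w              ≡⟨ cong (_+ w) i+k≡1+n ⟨
  i + (i + w) + w        ≡⟨ identity i w ⟩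
  (i + w) + (i + w)      ∎
  where
  open ≤-Reasoning
  identity : ∀ i w → i + (i + w) + w ≡ (i + w) + (i + w)
  identity = solve-∀

-- The tails from i and from k = i + w are complementary (i + k = n + 1) and differ by
-- w ≤ t + 1 binomial coefficients, each at most 2ⁿ/(M(t + 1)).
2*nC≥[i+w]≳2^n : ∀ M {t} n i w → w ≤ suc t → i + (i + w) ≡ suc n → (∀ l → M * suc t * (n C l) ≤ 2 ^ n) →
                 2 * (n C≥ (i + w)) ≳[ M ] 2 ^ n
2*nC≥[i+w]≳2^n M {t} n i w w≤1+t i+k≡1+n bound = *-cancelˡ-≤ (suc t) (begin
  suc t * (M * 2 ^ n)                          ≡⟨ identity₁ t M (2 ^ n) ⟩
  K * 2 ^ n                                    ≡⟨ cong (K *_) (nC≥i+nC≥k≡2^n n i k i+k≡1+n) ⟨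
  K * (n C≥ i + n C≥ k)                        ≡⟨ *-distribˡ-+ K (n C≥ i) (n C≥ k) ⟩
  K * (n C≥ i) + K * (n C≥ k)                  ≤⟨ +-monoˡ-≤ (K * (n C≥ k)) (K*nC≥i≤K*nC≥[i+w]+w*X K n bound i w) ⟩
  K * (n C≥ k) + w * 2 ^ n + K * (n C≥ k)      ≤⟨ +-monoˡ-≤ (K * (n C≥ k)) (+-monoʳ-≤ _ (*-monoˡ-≤ (2 ^ n) w≤1+t)) ⟩
  K * (n C≥ k) + suc t * 2 ^ n + K * (n C≥ k)  ≡⟨ identity₂ M t (n C≥ k) (2 ^ n) ⟩
  suc t * (M * (2 * (n C≥ k)) + 2 ^ n)         ∎)
  where
  open ≤-Reasoning
  K = M * suc t
  k = i + w
  identity₁ : ∀ t M p → suc t * (M * p) ≡ M * suc t * p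
  identity₁ = solve-∀
  identity₂ : ∀ M t g p → M * suc t * g + suc t * p + M * suc t * g ≡ suc t * (M * (2 * g) + p)
  identity₂ = solve-∀

∃[k]2*nC≥k≳2^n : ∀ M t n → t ≤ n → (∀ l → M * suc t * (n C l) ≤ 2 ^ n) →
                 ∃ λ k → n + t ≤ k + k × 2 * (n C≥ k) ≳[ M ] 2 ^ n
∃[k]2*nC≥k≳2^n M t n t≤n bound =
  let i , w , t≤w , w≤1+t , i+k≡1+n = ∃[i,w]i+[i+w]≡n (m≤n⇒m≤1+n t≤n)
  in i + w , n+t≤[i+w]+[i+w] i w (m≤n⇒m≤1+n t≤w) i+k≡1+n , 2*nC≥[i+w]≳2^n M n i w w≤1+t i+k≡1+n bound

-- (M(t + 1))² ≤ n bounds every binomial coefficient by 2ⁿ/(M(t + 1)), via K*nCk≤2^n.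
threshold : ℕ → ℕ → ℕ
threshold M t = t + M * suc t * (M * suc t)

∃[k]2*nC≥k≳2^n-beyond-threshold : ∀ M t n → threshold M t ≤ n → ∃ λ k → n + t ≤ k + k × 2 * (n C≥ k) ≳[ M ] 2 ^ n
∃[k]2*nC≥k≳2^n-beyond-threshold M t n ≥threshold =
  ∃[k]2*nC≥k≳2^n M t n (≤-trans (m≤m+n t _) ≥threshold) (K*nCk≤2^n (M * suc t) (≤-trans (m≤n+m _ t) ≥threshold))

occ : ∀ {n} → Fin 2 → Seq n → ℕ
occ ℓ = Vec.count (_≟ ℓ)

+-suc-mono-≤ : ∀ {a b c d} → a + b ≤ c + d → a + suc b ≤ c + suc d
+-suc-mono-≤ {a} {b} {c} {d} h = subst₂ _≤_ (sym (+-suc a b)) (sym (+-suc c d)) (s≤s h)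

occ+occ≤n+agree : ∀ {n} ℓ (x y : Seq n) → occ ℓ x + occ ℓ y ≤ n + agree ℓ x y
occ+occ≤n+agree ℓ [] [] = z≤n
occ+occ≤n+agree ℓ (a ∷ x) (b ∷ y) with a ≟ ℓ | b ≟ ℓ | occ+occ≤n+agree ℓ x y
... | yes _ | yes _ | ih = s≤s (+-suc-mono-≤ ih)
... | yes _ | no _  | ih = s≤s ih
... | no _  | yes _ | ih = ≤-trans (≤-reflexive (+-suc (occ ℓ x) (occ ℓ y))) (s≤s ih)
... | no _  | no _  | ih = m≤n⇒m≤1+n ih

k≤occ⇒t≤agree : ∀ {n t k} ℓ (x y : Seq n) → n + t ≤ k + k → k ≤ occ ℓ x → k ≤ occ ℓ y → t ≤ agree ℓ x y
k≤occ⇒t≤agree {n} {t} {k} ℓ x y n+t≤2k k≤x k≤y = +-cancelˡ-≤ n t (agree ℓ x y) (begin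
  n + t                    ≤⟨ n+t≤2k ⟩
  k + k                    ≤⟨ +-mono-≤ k≤x k≤y ⟩
  occ ℓ x + occ ℓ y        ≤⟨ occ+occ≤n+agree ℓ x y ⟩
  n + agree ℓ x y          ∎)
  where open ≤-Reasoning

agree-take-drop : ∀ a {b} ℓ (v w : Seq (a + b)) →
                  agree ℓ v w ≡ agree ℓ (take a v) (take a w) + agree ℓ (drop a v) (drop a w)
agree-take-drop zero    ℓ v w = refl
agree-take-drop (suc a) ℓ (x ∷ v) (y ∷ w) with x ≟ ℓ | y ≟ ℓ
... | yes _ | yes _ = cong suc (agree-take-drop a ℓ v w)
... | yes _ | no _  = agree-take-drop a ℓ v w
... | no _  | _     = agree-take-drop a ℓ v w

[1+k]≤ᵇ[1+m]≡k≤ᵇm : ∀ k m → (suc k ≤ᵇ suc m) ≡ (k ≤ᵇ m)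
[1+k]≤ᵇ[1+m]≡k≤ᵇm zero    m = refl
[1+k]≤ᵇ[1+m]≡k≤ᵇm (suc k) m = refl

count-k≤occ : ∀ ℓ n k → count n (λ x → k ≤ᵇ occ ℓ x) ≡ n C≥ k
count-k≤occ ℓ       zero    zero    = refl
count-k≤occ ℓ       zero    (suc k) = refl
count-k≤occ ℓ       (suc n) zero    = count-true (suc n)
count-k≤occ zero    (suc n) (suc k) =
  cong₂ _+_ (trans (count-cong n (λ x → [1+k]≤ᵇ[1+m]≡k≤ᵇm k (occ zero x))) (count-k≤occ zero n k))
            (count-k≤occ zero n (suc k))
count-k≤occ (suc zero) (suc n) (suc k) =
  trans (cong₂ _+_ (count-k≤occ (suc zero) n (suc k))
                   (trans (count-cong n (λ x → [1+k]≤ᵇ[1+m]≡k≤ᵇm k (occ (suc zero) x))) (count-k≤occ (suc zero) n k)))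
        (+-comm (n C≥ suc k) (n C≥ k))

-- The sequences with at least k₁ symbols 1 among their first a coordinates and at least k₂
-- symbols 2 among the last b: two of them share at least 2k₁ - a ≥ t₁ 1's and 2k₂ - b ≥ t₂ 2's.
[aC≥k₁]*[bC≥k₂]≤maxFamily : ∀ {t₁ t₂} a b k₁ k₂ → a + t₁ ≤ k₁ + k₁ → b + t₂ ≤ k₂ + k₂ →
                            (a C≥ k₁) * (b C≥ k₂) ≤ maxFamily (a + b) t₁ t₂
[aC≥k₁]*[bC≥k₂]≤maxFamily {t₁} {t₂} a b k₁ k₂ a+t₁≤2k₁ b+t₂≤2k₂ = begin
  (a C≥ k₁) * (b C≥ k₂)    ≡⟨ cong₂ _*_ (count-k≤occ zero a k₁) (count-k≤occ (suc zero) b k₂) ⟨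
  count a P * count b Q    ≡⟨ count-take-drop a P Q ⟨
  count (a + b) PQ         ≤⟨ count≤maxFamily PQ intersecting ⟩
  maxFamily (a + b) t₁ t₂  ∎
  where
  open ≤-Reasoning
  P : Seq a → Bool
  P x = k₁ ≤ᵇ occ zero x
  Q : Seq b → Bool
  Q y = k₂ ≤ᵇ occ (suc zero) y
  PQ : Seq (a + b) → Bool
  PQ v = P (take a v) ∧ Q (drop a v)
  bounds : ∀ v → T (PQ v) → k₁ ≤ occ zero (take a v) × k₂ ≤ occ (suc zero) (drop a v)
  bounds v PQv with Equivalence.to (T-∧ {P (take a v)}) PQv
  ... | Pv , Qv = ≤ᵇ⇒≤ k₁ _ Pv , ≤ᵇ⇒≤ k₂ _ Qv
  intersecting : ∀ {v w} → T (PQ v) → T (PQ w) → Pair-ok t₁ t₂ v w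
  intersecting {v} {w} PQv PQw with bounds v PQv | bounds w PQw
  ... | k₁≤v , k₂≤v | k₁≤w , k₂≤w =
    ≤-trans (k≤occ⇒t≤agree zero (take a v) (take a w) a+t₁≤2k₁ k₁≤v k₁≤w)
            (≤-trans (m≤m+n _ _) (≤-reflexive (sym (agree-take-drop a zero v w)))) ,
    ≤-trans (k≤occ⇒t≤agree (suc zero) (drop a v) (drop a w) b+t₂≤2k₂ k₂≤v k₂≤w)
            (≤-trans (m≤n+m _ _) (≤-reflexive (sym (agree-take-drop a (suc zero) v w))))

4*maxFamily[a+b]≳2^[a+b] : ∀ M {t₁ t₂} a b → threshold (3 * M) t₁ ≤ a → threshold (3 * M) t₂ ≤ b →
                           4 * maxFamily (a + b) t₁ t₂ ≳[ M ] 2 ^ (a + b)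
4*maxFamily[a+b]≳2^[a+b] M {t₁} {t₂} a b a≥threshold b≥threshold
  with ∃[k]2*nC≥k≳2^n-beyond-threshold (3 * M) t₁ a a≥threshold | ∃[k]2*nC≥k≳2^n-beyond-threshold (3 * M) t₂ b b≥threshold
... | k₁ , a+t₁≤2k₁ , u≳2^a | k₂ , b+t₂≤2k₂ , v≳2^b =
  subst (4 * maxFamily (a + b) t₁ t₂ ≳[ M ]_) (sym (^-distribˡ-+-* 2 a b)) (≳-mono-≤ {M} u*v≤4*maxFamily u*v≳2^a*2^b)
  where
  u = 2 * (a C≥ k₁)
  v = 2 * (b C≥ k₂)
  u*v≳2^a*2^b : u * v ≳[ M ] 2 ^ a * 2 ^ b
  u*v≳2^a*2^b = ≳-* {M} u≳2^a v≳2^b (*-monoʳ-≤ 2 (nC≥k≤2^n a k₁))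
  identity : ∀ x y → (2 * x) * (2 * y) ≡ 4 * (x * y)
  identity = solve-∀
  u*v≤4*maxFamily : u * v ≤ 4 * maxFamily (a + b) t₁ t₂
  u*v≤4*maxFamily = begin
    u * v                                ≡⟨ identity (a C≥ k₁) (b C≥ k₂) ⟩
    4 * ((a C≥ k₁) * (b C≥ k₂))          ≤⟨ *-monoʳ-≤ 4 ([aC≥k₁]*[bC≥k₂]≤maxFamily a b k₁ k₂ a+t₁≤2k₁ b+t₂≤2k₂) ⟩
    4 * maxFamily (a + b) t₁ t₂          ∎
    where open ≤-Reasoning

∃[N]4*maxFamily≳2^n : ∀ M t₁ t₂ → ∃ λ N → ∀ n → N ≤ n → 4 * maxFamily n t₁ t₂ ≳[ M ] 2 ^ n
∃[N]4*maxFamily≳2^n M t₁ t₂ = a + threshold (3 * M) t₂ , bound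
  where
  a = threshold (3 * M) t₁
  bound : ∀ n → a + threshold (3 * M) t₂ ≤ n → 4 * maxFamily n t₁ t₂ ≳[ M ] 2 ^ n
  bound n N≤n with m≤n⇒∃[o]m+o≡n (m+n≤o⇒m≤o a N≤n)
  ... | b , refl = 4*maxFamily[a+b]≳2^[a+b] M a b ≤-refl (+-cancelˡ-≤ a _ _ N≤n)

-- Distance to 1/4

-- The left-hand side is the numerator of the unnormalised difference m/(k + 1) - 1/4.
∣m*4-[1+k]∣≡1+k∸4*m : ∀ m k → 4 * m ≤ suc k → ℤ.∣ + m ℤ.* + 4 ℤ.+ (ℤ.- + 1) ℤ.* + suc k ∣ ≡ suc k ∸ 4 * m
∣m*4-[1+k]∣≡1+k∸4*m m k 4m≤D = begin
  ℤ.∣ + m ℤ.* + 4 ℤ.+ (ℤ.- + 1) ℤ.* + suc k ∣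
    ≡⟨ cong₂ (λ u v → ℤ.∣ u ℤ.+ v ∣) (trans (ℤ.*-comm (+ m) (+ 4)) (sym (ℤ.pos-* 4 m))) (ℤ.-1*i≡-i (+ suc k)) ⟩
  ℤ.∣ + (4 * m) ℤ.- + suc k ∣
    ≡⟨ cong ℤ.∣_∣ (ℤ.m-n≡m⊖n (4 * m) (suc k)) ⟩
  ℤ.∣ 4 * m ℤ.⊖ suc k ∣
    ≡⟨ cong ℤ.∣_∣ (ℤ.⊖-≤ 4m≤D) ⟩
  ℤ.∣ ℤ.- + (suc k ∸ 4 * m) ∣
    ≡⟨ ℤ.∣-i∣≡∣i∣ (+ (suc k ∸ 4 * m)) ⟩
  suc k ∸ 4 * m ∎
  where open ≡-Reasoning

toℚᵘ-∣m/[1+k]-¼∣ : ∀ m k → 4 * m ≤ suc k → toℚᵘ ∣ + m / suc k - + 1 / 4 ∣ ≃ mkℚᵘ (+ (suc k ∸ 4 * m)) (3 + k * 4)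
toℚᵘ-∣m/[1+k]-¼∣ m k 4m≤D = ℚᵘ.≃-trans
  (ℚᵘ.≃-trans (ℚ.toℚᵘ-homo-∣-∣ (+ m / suc k - + 1 / 4))
              (ℚᵘ.∣-∣-cong (ℚᵘ.≃-trans (ℚ.toℚᵘ-homo-+ (+ m / suc k) (-ℚ (+ 1 / 4)))
                                        (ℚᵘ.+-cong (ℚ.toℚᵘ-fromℚᵘ (mkℚᵘ (+ m) k)) (ℚ.toℚᵘ-homo‿- (+ 1 / 4))))))
  (ℚᵘ.≃-reflexive (cong (λ x → mkℚᵘ (+ x) (3 + k * 4)) (∣m*4-[1+k]∣≡1+k∸4*m m k 4m≤D)))

∣m/D-¼∣<[1+a]/[1+e] : ∀ {a e} .(c : Coprime (suc a) (suc e)) m D .{{_ : NonZero D}} →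
                      4 * m ≤ D → 4 * m ≳[ suc e ] D → ∣ + m / D - + 1 / 4 ∣ < mkℚ (+ suc a) e c
∣m/D-¼∣<[1+a]/[1+e] c m zero {{D≢0}} = Irrelevant.⊥-elim (NonZero.nonZero D≢0)
∣m/D-¼∣<[1+a]/[1+e] {a} {e} c m (suc k) 4m≤D 4m≳D =
  ℚ.toℚᵘ-cancel-< (ℚᵘ.<-respˡ-≃ (ℚᵘ.≃-sym (toℚᵘ-∣m/[1+k]-¼∣ m k 4m≤D)) (ℚᵘ.*<* numerators<))
  where
  open ≤-Reasoning
  numerators< : + (suc k ∸ 4 * m) ℤ.* + suc e ℤ.< + suc a ℤ.* + (suc k * 4)
  numerators< = subst₂ ℤ._<_ (ℤ.pos-* (suc k ∸ 4 * m) (suc e)) (ℤ.pos-* (suc a) (suc k * 4)) (+<+ (begin-strict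
    (suc k ∸ 4 * m) * suc e    ≡⟨ *-comm _ (suc e) ⟩
    suc e * (suc k ∸ 4 * m)    ≤⟨ ≳⇒*∸≤ {suc e} {suc k} {4 * m} 4m≳D ⟩
    suc k                      <⟨ m<m*n (suc k) 4 (s≤s (s≤s z≤n)) ⟩
    suc k * 4                  ≤⟨ m≤n*m (suc k * 4) (suc a) ⟩
    suc a * (suc k * 4)        ∎))

-- With M the denominator of ε we have ε ≥ 1/M, while the hypotheses bound the error by 1/(4M).
quarter-approximation : (ε : ℚ) → 0ℚ < ε → ∃ λ M → ∀ m D .{{_ : NonZero D}} →
                        4 * m ≤ D → 4 * m ≳[ M ] D → ∣ + m / D - + 1 / 4 ∣ < ε
quarter-approximation (mkℚ (+ suc a) e c) _ = suc e , ∣m/D-¼∣<[1+a]/[1+e] c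
quarter-approximation (mkℚ (+ zero)  e c) (*<* (+<+ ()))
quarter-approximation (mkℚ -[1+ a ]  e c) (*<* ())

claim1 : (t₁ t₂ : ℕ) → t₁ ≥ 1 → t₂ ≥ 1 →
    (ε : ℚ) → 0ℚ < ε →
    ∃ λ (N : ℕ) → (n : ℕ) → n ≥ N → ∣ p n t₁ t₂ - (+ 1 / 4) ∣ < ε
claim1 t₁ t₂ t₁≥1 t₂≥1 ε ε>0 =
  let M , close = quarter-approximation ε ε>0
      N , ≳2^n  = ∃[N]4*maxFamily≳2^n M t₁ t₂
  in 2 + N , λ n n≥2+N → close (maxFamily n t₁ t₂) (2 ^ n) {{m^n≢0 2 n}}
                           (4*maxFamily≤2^n t₁≥1 t₂≥1 (≤-trans (m≤m+n 2 N) n≥2+N))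
                           (≳2^n n (≤-trans (m≤n+m N 2) n≥2+N))
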